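{- Let $G$ be a circuit with leaves labeled by literals over $\mathbf{I}$ and $\mathbf{X}$, and let $\mathcal{G}_1=\{G_{1,1},\dots,G_{1,s}\}$ and $\mathcal{G}_2=\{G_{2,1},\dots,G_{2,t}\}$ be two sets of sub-circuits of $G$ such that (a) there are no two distinct sub-circuits $G_{k,i},G_{l,j}$ in $\mathcal{G}_1\cup\mathcal{G}_2$ one of which is a sub-circuit of the other, and (b) $\bigvee_{i=1}^s\varphi_{G_{1,i}}\Rightarrow\bigwedge_{j=1}^t\neg\varphi_{G_{2,j}}$. Let $p\notin\mathrm{set}(\mathbf{X})\cup\mathrm{set}(\mathbf{I})$ be a fresh variable. Then $G$ is equisynthesizable under projection to $T_{\mathcal{G}_1}^{p}(T_{\mathcal{G}_2}^{\neg p}(G))$ (with auxiliary output sequence $(p)$).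
   Context: $\mathbf{I}$ (system inputs) and $\mathbf{X}$ (system outputs) are disjoint sequences of Boolean variables; $\mathrm{set}(\mathbf{V})$ is the set of variables of $\mathbf{V}$. A circuit is an NNF circuit: a rooted DAG, all nodes descendants of the root, internal nodes labeled $\wedge$ or $\vee$ with two children, leaves labeled by literals or constants; $\varphi_G$ is the represented formula. A sub-circuit is the circuit rooted at some node. For $k\in\{1,2\}$ and a literal $q$, $T_{\mathcal{G}_k}^{q}$ is the transformation that replaces every sub-circuit $G_{k,i}\in\mathcal{G}_k$ of $G$ by a circuit representing $\varphi_{G_{k,i}}\wedge q$. For a circuit $G$ over $\mathbf{I},\mathbf{X}$ and a circuit $H$ over $\mathbf{I},\mathbf{X},\mathbf{X}'$ with $\mathbf{X}'$ fresh, $G$ is equisynthesizable to $H$ under projection iff $\forall\mathbf{I}\forall\mathbf{X}\,(\varphi_G(\mathbf{X},\mathbf{I})\Rightarrow\exists\mathbf{X}'\varphi_H(\mathbf{X},\mathbf{X}',\mathbf{I}))$ and $\forall\mathbf{I}\forall\mathbf{X}\forall\mathbf{X}'\,(\varphi_H(\mathbf{X},\mathbf{X}',\mathbf{I})\Rightarrow\varphi_G(\mathbf{X},\mathbf{I}))$. -}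

module Defs where

open import Data.Bool using (Bool; true; false; _∧_; _∨_; not)
open import Data.Nat using (ℕ; zero; suc; _*_)
open import Data.Fin using (Fin; zero; suc; combine; remQuot)
open import Data.List using (List; []; _∷_; map)
open import Data.List.Membership.Propositional using (_∈_)
open import Data.Product using (Σ; ∃; _×_; _,_; proj₁; proj₂)
open import Data.Sum using (_⊎_; inj₁; inj₂; [_,_])
open import Relation.Binary.PropositionalEquality using (_≡_)
open import Relation.Nullary using (¬_)

-- A circuit with n nodes is a list of gates, newest node first.
-- The gate at position 0 (the root) may only refer (by index) to nodes
-- strictly below it, which makes the graph acyclic by construction.
-- A node's index i : Fin n counts how many nodes lie above it.

data Lit (V : Set) : Set where
  pos : V → Lit V
  neg : V → Lit V

data Gate (V : Set) (k : ℕ) : Set where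
  lit   : Lit V → Gate V k
  const : Bool → Gate V k
  and   : Fin k → Fin k → Gate V k
  or    : Fin k → Fin k → Gate V k

data Gates (V : Set) : ℕ → Set where
  []  : Gates V 0
  _◁_ : ∀ {k} → Gate V k → Gates V k → Gates V (suc k)

infixr 5 _◁_

evalLit : ∀ {V} → (V → Bool) → Lit V → Bool
evalLit ρ (pos v) = ρ v
evalLit ρ (neg v) = not (ρ v)

evalGate : ∀ {V k} → (V → Bool) → (Fin k → Bool) → Gate V k → Bool
evalGate ρ val (lit l)   = evalLit ρ l
evalGate ρ val (const b) = b
evalGate ρ val (and a b) = val a ∧ val b
evalGate ρ val (or a b)  = val a ∨ val b

eval : ∀ {V n} → Gates V n → (V → Bool) → Fin n → Bool
eval (g ◁ gs) ρ zero    = evalGate ρ (eval gs ρ) g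
eval (g ◁ gs) ρ (suc i) = eval gs ρ i

⟦_⟧ : ∀ {V m} → Gates V (suc m) → (V → Bool) → Bool
⟦ G ⟧ ρ = eval G ρ zero

gateChildren : ∀ {V k} → Gate V k → List (Fin k)
gateChildren (lit _)   = []
gateChildren (const _) = []
gateChildren (and a b) = a ∷ b ∷ []
gateChildren (or a b)  = a ∷ b ∷ []

children : ∀ {V n} → Gates V n → Fin n → List (Fin n)
children (g ◁ gs) zero    = map suc (gateChildren g)
children (g ◁ gs) (suc i) = map suc (children gs i)

-- Desc G a b : node b is a descendant of node a (reflexively), i.e. the
-- sub-circuit rooted at b is a sub-circuit of the one rooted at a.
data Desc {V n} (G : Gates V n) : Fin n → Fin n → Set where
  here : ∀ {a} → Desc G a a
  step : ∀ {a b c} → b ∈ children G a → Desc G b c → Desc G a c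

IsCircuit : ∀ {V m} → Gates V (suc m) → Set
IsCircuit {m = m} G = ∀ (i : Fin (suc m)) → Desc G zero i

NoConstGate : ∀ {V k} → Gate V k → Set
NoConstGate (const _) = Data.Empty.⊥
  where import Data.Empty
NoConstGate _ = Data.Unit.⊤
  where import Data.Unit

data NoConsts {V : Set} : ∀ {n} → Gates V n → Set where
  []  : NoConsts []
  _◁_ : ∀ {k} {g : Gate V k} {gs : Gates V k} →
        NoConstGate g → NoConsts gs → NoConsts (g ◁ gs)

mapLit : ∀ {V W} → (V → W) → Lit V → Lit W
mapLit f (pos v) = pos (f v)
mapLit f (neg v) = neg (f v)

mapGate : ∀ {V W k} → (V → W) → Gate V k → Gate W k
mapGate f (lit l)   = lit (mapLit f l)
mapGate f (const b) = const b
mapGate f (and a b) = and a b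
mapGate f (or a b)  = or a b

mapVars : ∀ {V W n} → (V → W) → Gates V n → Gates W n
mapVars f []        = []
mapVars f (g ◁ gs)  = mapGate f g ◁ mapVars f gs

-- The transformation T^q_S : every node i with S i = true, i.e. every
-- sub-circuit G_i in the set S, is replaced by a circuit representing
-- φ_{G_i} ∧ q.  Concretely each node i becomes a block of three nodes
-- (newest first):
--   3i     : and (3i+2) (3i+1)        -- the new node standing for i
--   3i+1   : literal q  (if S i)  or  const true (if not S i)
--   3i+2   : the original gate of i, children c redirected to 3c
-- For unmarked nodes the block represents φ ∧ true, i.e. the same formula.
-- Node i of the old circuit corresponds to node combine i 0 = 3i.

reindexGate : ∀ {V k} → Gate V k → Gate V (k * 3)
reindexGate (lit l)   = lit l
reindexGate (const b) = const b
reindexGate (and a b) = and (combine a zero) (combine b zero)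
reindexGate (or a b)  = or (combine a zero) (combine b zero)

T : ∀ {V n} → Gates V n → (Fin n → Bool) → Lit V → Gates V (n * 3)
T []       S q = []
T (g ◁ gs) S q =
  and (suc zero) zero
  ◁ (markGate (S zero))
  ◁ reindexGate g
  ◁ T gs (λ i → S (suc i)) q
  where
  markGate : ∀ {k} → Bool → Gate _ k
  markGate true  = lit q
  markGate false = const true

-- Transport a set of nodes along T: node combine i 0 (= 3i) of T G S q is
-- the node standing for node i of G.
isZero3 : Fin 3 → Bool
isZero3 zero    = true
isZero3 (suc _) = false

liftSet : ∀ {n} → (Fin n → Bool) → Fin (n * 3) → Bool
liftSet {n} S j with remQuot {n} 3 j
... | (i , r) = S i ∧ isZero3 r

-- Synthesis setting: inputs I = (i_0..i_{nI-1}), outputs X = (x_0..x_{nX-1})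
-- (disjoint by construction); auxiliary outputs X' = (x'_0..x'_{nX'-1}).

SysVar : ℕ → ℕ → Set
SysVar nI nX = Fin nI ⊎ Fin nX

AuxVar : ℕ → ℕ → ℕ → Set
AuxVar nI nX nX' = SysVar nI nX ⊎ Fin nX'

EquisynthProj : ∀ {nI nX nX' m m'} →
  Gates (SysVar nI nX) (suc m) → Gates (AuxVar nI nX nX') (suc m') → Set
EquisynthProj {nI} {nX} {nX'} G H =
  (∀ (I : Fin nI → Bool) (X : Fin nX → Bool) →
     ⟦ G ⟧ [ I , X ] ≡ true →
     Σ (Fin nX' → Bool) λ X' → ⟦ H ⟧ [ [ I , X ] , X' ] ≡ true)
  × (∀ (I : Fin nI → Bool) (X : Fin nX → Bool) (X' : Fin nX' → Bool) →
     ⟦ H ⟧ [ [ I , X ] , X' ] ≡ true → ⟦ G ⟧ [ I , X ] ≡ true)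

pVar : ∀ {nI nX} → AuxVar nI nX 1
pVar = inj₂ zero

-- Both transformations only conjoin a guard to nodes, so evaluating
-- T^p_{G₁}(T^{¬p}_{G₂}(G)) amounts to evaluating G with the value of each
-- node i conjoined with (i ∈ G₂ → ¬p) ∧ (i ∈ G₁ → p).  NNF gates are
-- monotone, so guards can only falsify the root: this is the backward
-- direction.  For the forward direction let p say "some node of G₁ is true";
-- by (b) every guard that then fails sits at a node which is false anyway,
-- so the guards change nothing.
module Submission where

open import Defs
open import Data.Bool using (Bool; true; false; _∧_; _∨_)
open import Data.Bool.Properties using (_≟_; ∧-assoc; ∧-identityʳ; ∧-zeroʳ; ∨-zeroʳ; ∧-conicalˡ; ∧-conicalʳ)
open import Data.Nat using (ℕ; suc; _*_)
open import Data.Fin using (Fin; zero; suc; combine; #_)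
open import Data.Fin.Properties using (remQuot-combine; any?)
open import Data.Product using (Σ; _×_; _,_)
open import Data.Sum using (inj₁; [_,_])
open import Data.Empty using (⊥-elim)
open import Function using (_∘_)
open import Relation.Binary.PropositionalEquality using (_≡_; _≢_; refl; sym; trans; cong; cong₂; module ≡-Reasoning)
open import Relation.Nullary using (¬_; yes; no; contradiction)

evalGate-cong : ∀ {V k} (ρ : V → Bool) {f h : Fin k → Bool} →
  (∀ i → f i ≡ h i) → ∀ g → evalGate ρ f g ≡ evalGate ρ h g
evalGate-cong ρ f≗h (lit l)   = refl
evalGate-cong ρ f≗h (const b) = refl
evalGate-cong ρ f≗h (and a b) = cong₂ _∧_ (f≗h a) (f≗h b)
evalGate-cong ρ f≗h (or a b)  = cong₂ _∨_ (f≗h a) (f≗h b)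

evalGate-mono : ∀ {V k} (ρ : V → Bool) {f h : Fin k → Bool} →
  (∀ i → f i ≡ true → h i ≡ true) → ∀ g → evalGate ρ f g ≡ true → evalGate ρ h g ≡ true
evalGate-mono ρ f⇒h (lit l)   e = e
evalGate-mono ρ f⇒h (const b) e = e
evalGate-mono ρ {f} f⇒h (and a b) e
  rewrite f⇒h a (∧-conicalˡ (f a) (f b) e) | f⇒h b (∧-conicalʳ (f a) (f b) e) = refl
evalGate-mono ρ {f} {h} f⇒h (or a b) e with f a in fa
... | true  rewrite f⇒h a fa = refl
... | false rewrite f⇒h b e  = ∨-zeroʳ (h a)

evalGate-mapGate : ∀ {V W k} (φ : V → W) (ρ : W → Bool) (f : Fin k → Bool) g →
  evalGate ρ f (mapGate φ g) ≡ evalGate (ρ ∘ φ) f g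
evalGate-mapGate φ ρ f (lit (pos v)) = refl
evalGate-mapGate φ ρ f (lit (neg v)) = refl
evalGate-mapGate φ ρ f (const b)     = refl
evalGate-mapGate φ ρ f (and a b)     = refl
evalGate-mapGate φ ρ f (or a b)      = refl

evalGate-reindexGate : ∀ {V k} (ρ : V → Bool) {f : Fin (k * 3) → Bool} {h : Fin k → Bool} →
  (∀ i → f (combine i zero) ≡ h i) → ∀ g → evalGate ρ f (reindexGate g) ≡ evalGate ρ h g
evalGate-reindexGate ρ f≗h (lit l)   = refl
evalGate-reindexGate ρ f≗h (const b) = refl
evalGate-reindexGate ρ f≗h (and a b) = cong₂ _∧_ (f≗h a) (f≗h b)
evalGate-reindexGate ρ f≗h (or a b)  = cong₂ _∨_ (f≗h a) (f≗h b)

-- T realises exactly such masks (evalMasked-T).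
evalMasked : ∀ {V n} → Gates V n → (V → Bool) → (Fin n → Bool) → Fin n → Bool
evalMasked (g ◁ gs) ρ M zero    = evalGate ρ (evalMasked gs ρ (M ∘ suc)) g ∧ M zero
evalMasked (g ◁ gs) ρ M (suc i) = evalMasked gs ρ (M ∘ suc) i

evalMasked-cong : ∀ {V n} (G : Gates V n) ρ {M N : Fin n → Bool} →
  (∀ i → M i ≡ N i) → ∀ i → evalMasked G ρ M i ≡ evalMasked G ρ N i
evalMasked-cong (g ◁ gs) ρ M≗N zero =
  cong₂ _∧_ (evalGate-cong ρ (evalMasked-cong gs ρ (M≗N ∘ suc)) g) (M≗N zero)
evalMasked-cong (g ◁ gs) ρ M≗N (suc i) = evalMasked-cong gs ρ (M≗N ∘ suc) i

eval≡evalMasked-true : ∀ {V n} (G : Gates V n) ρ i → eval G ρ i ≡ evalMasked G ρ (λ _ → true) i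
eval≡evalMasked-true (g ◁ gs) ρ zero =
  trans (evalGate-cong ρ (eval≡evalMasked-true gs ρ) g) (sym (∧-identityʳ _))
eval≡evalMasked-true (g ◁ gs) ρ (suc i) = eval≡evalMasked-true gs ρ i

evalMasked⇒eval : ∀ {V n} (G : Gates V n) ρ M i → evalMasked G ρ M i ≡ true → eval G ρ i ≡ true
evalMasked⇒eval (g ◁ gs) ρ M zero e =
  evalGate-mono ρ (evalMasked⇒eval gs ρ (M ∘ suc)) g (∧-conicalˡ _ (M zero) e)
evalMasked⇒eval (g ◁ gs) ρ M (suc i) e = evalMasked⇒eval gs ρ (M ∘ suc) i e

evalMasked≡eval : ∀ {V n} (G : Gates V n) ρ M → (∀ i → eval G ρ i ≡ true → M i ≡ true) →
  ∀ i → evalMasked G ρ M i ≡ eval G ρ i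
evalMasked≡eval (g ◁ gs) ρ M true⇒M zero
  rewrite evalGate-cong ρ (evalMasked≡eval gs ρ (M ∘ suc) (true⇒M ∘ suc)) g
  with evalGate ρ (eval gs ρ) g in e
... | true  rewrite true⇒M zero e = refl
... | false = refl
evalMasked≡eval (g ◁ gs) ρ M true⇒M (suc i) = evalMasked≡eval gs ρ (M ∘ suc) (true⇒M ∘ suc) i

evalMasked-mapVars : ∀ {V W n} (φ : V → W) (G : Gates V n) ρ M i →
  evalMasked (mapVars φ G) ρ M i ≡ evalMasked G (ρ ∘ φ) M i
evalMasked-mapVars φ (g ◁ gs) ρ M zero = cong (_∧ M zero) (begin
  evalGate ρ (evalMasked (mapVars φ gs) ρ (M ∘ suc)) (mapGate φ g)
    ≡⟨ evalGate-mapGate φ ρ _ g ⟩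
  evalGate (ρ ∘ φ) (evalMasked (mapVars φ gs) ρ (M ∘ suc)) g
    ≡⟨ evalGate-cong (ρ ∘ φ) (evalMasked-mapVars φ gs ρ (M ∘ suc)) g ⟩
  evalGate (ρ ∘ φ) (evalMasked gs (ρ ∘ φ) (M ∘ suc)) g ∎)
  where open ≡-Reasoning
evalMasked-mapVars φ (g ◁ gs) ρ M (suc i) = evalMasked-mapVars φ gs ρ (M ∘ suc) i

markValue : ∀ {V} → Bool → Lit V → (V → Bool) → Bool
markValue true  q ρ = evalLit ρ q
markValue false q ρ = true

-- The mask on G induced by a mask M on the three nodes 3i, 3i+1, 3i+2 that
-- T G S q introduces for node i.
T-mask : ∀ {V n} → (Fin n → Bool) → Lit V → (V → Bool) → (Fin (n * 3) → Bool) → Fin n → Bool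
T-mask S q ρ M i = (M (combine i (# 2)) ∧ (markValue (S i) q ρ ∧ M (combine i (# 1)))) ∧ M (combine i (# 0))

∧-regroup : ∀ {a a′} b c d → a ≡ a′ → ((a ∧ b) ∧ c) ∧ d ≡ a′ ∧ ((b ∧ c) ∧ d)
∧-regroup {a} b c d refl = trans (cong (_∧ d) (∧-assoc a b c)) (∧-assoc a (b ∧ c) d)

evalMasked-T : ∀ {V n} (G : Gates V n) S q ρ M i →
  evalMasked (T G S q) ρ M (combine i zero) ≡ evalMasked G ρ (T-mask S q ρ M) i
evalMasked-T (g ◁ gs) S q ρ M zero with S zero
... | true  = ∧-regroup _ _ (M (# 0)) (evalGate-reindexGate ρ (evalMasked-T gs (S ∘ suc) q ρ _) g)
... | false = ∧-regroup _ _ (M (# 0)) (evalGate-reindexGate ρ (evalMasked-T gs (S ∘ suc) q ρ _) g)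
evalMasked-T (g ◁ gs) S q ρ M (suc i) = evalMasked-T gs (S ∘ suc) q ρ (λ j → M (suc (suc (suc j)))) i

liftSet-combine : ∀ {n} (S : Fin n → Bool) i r → liftSet S (combine i r) ≡ S i ∧ isZero3 r
liftSet-combine S i r = cong (λ (j , s) → S j ∧ isZero3 s) (remQuot-combine {k = 3} i r)

T-mask-true : ∀ {V n} (S : Fin n → Bool) (q : Lit V) ρ i → T-mask S q ρ (λ _ → true) i ≡ markValue (S i) q ρ
T-mask-true S q ρ i = trans (∧-identityʳ _) (∧-identityʳ _)

eval-T-liftSet-T : ∀ {V n} (G : Gates V n) S₁ S₂ (q₁ q₂ : Lit V) ρ i →
  eval (T (T G S₂ q₂) (liftSet S₁) q₁) ρ (combine (combine i zero) zero)
  ≡ evalMasked G ρ (λ j → markValue (S₂ j) q₂ ρ ∧ markValue (S₁ j) q₁ ρ) i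
eval-T-liftSet-T G S₁ S₂ q₁ q₂ ρ i = begin
  eval (T (T G S₂ q₂) (liftSet S₁) q₁) ρ _
    ≡⟨ eval≡evalMasked-true (T (T G S₂ q₂) (liftSet S₁) q₁) ρ _ ⟩
  evalMasked (T (T G S₂ q₂) (liftSet S₁) q₁) ρ (λ _ → true) _
    ≡⟨ evalMasked-T (T G S₂ q₂) (liftSet S₁) q₁ ρ _ _ ⟩
  evalMasked (T G S₂ q₂) ρ outer (combine i zero)
    ≡⟨ evalMasked-T G S₂ q₂ ρ outer i ⟩
  evalMasked G ρ (T-mask S₂ q₂ ρ outer) i
    ≡⟨ evalMasked-cong G ρ guards i ⟩
  evalMasked G ρ (λ j → markValue (S₂ j) q₂ ρ ∧ markValue (S₁ j) q₁ ρ) i ∎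
  where
  open ≡-Reasoning
  outer = T-mask (liftSet S₁) q₁ ρ (λ _ → true)
  outer-combine : ∀ j r → outer (combine j r) ≡ markValue (S₁ j ∧ isZero3 r) q₁ ρ
  outer-combine j r = trans (T-mask-true (liftSet S₁) q₁ ρ _) (cong (λ s → markValue s q₁ ρ) (liftSet-combine S₁ j r))
  guards : ∀ j → T-mask S₂ q₂ ρ outer j ≡ markValue (S₂ j) q₂ ρ ∧ markValue (S₁ j) q₁ ρ
  guards j rewrite outer-combine j (# 0) | outer-combine j (# 1) | outer-combine j (# 2)
                 | ∧-zeroʳ (S₁ j) | ∧-identityʳ (S₁ j) = cong (_∧ markValue (S₁ j) q₁ ρ) (∧-identityʳ _)

markValue-neg∧pos : ∀ {V} (ρ : V → Bool) x s₂ s₁ →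
  (ρ x ≡ true → s₂ ≢ true) → (ρ x ≡ false → s₁ ≢ true) →
  markValue s₂ (neg x) ρ ∧ markValue s₁ (pos x) ρ ≡ true
markValue-neg∧pos ρ x false false _ _ = refl
markValue-neg∧pos ρ x false true ¬s₂ ¬s₁ with ρ x
... | true  = refl
... | false = ⊥-elim (¬s₁ refl refl)
markValue-neg∧pos ρ x true s₁ ¬s₂ ¬s₁ with ρ x
markValue-neg∧pos ρ x true s₁     ¬s₂ ¬s₁ | true  = ⊥-elim (¬s₂ refl refl)
markValue-neg∧pos ρ x true false  ¬s₂ ¬s₁ | false = refl
markValue-neg∧pos ρ x true true   ¬s₂ ¬s₁ | false = ⊥-elim (¬s₁ refl refl)

lemma5 : ∀ {nI nX m : ℕ}
    (G : Gates (SysVar nI nX) (suc m))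
    (S₁ S₂ : Fin (suc m) → Bool) →
    IsCircuit G →
    NoConsts G →
    (∀ a b → (S₁ a ∨ S₂ a) ≡ true → (S₁ b ∨ S₂ b) ≡ true → a ≢ b → ¬ Desc G a b) →
    (∀ (I : Fin nI → Bool) (X : Fin nX → Bool) →
      Σ (Fin (suc m)) (λ i → S₁ i ≡ true × eval G [ I , X ] i ≡ true) →
      ∀ j → S₂ j ≡ true → eval G [ I , X ] j ≡ false) →
    EquisynthProj {nX' = 1} G
      (T (T (mapVars inj₁ G) S₂ (neg pVar)) (liftSet S₁) (pos pVar))
lemma5 {nI} {nX} {m} G S₁ S₂ _ _ _ G₁⇒¬G₂ = complete , sound
  where
  H : Gates (AuxVar nI nX 1) (suc m * 3 * 3)
  H = T (T (mapVars inj₁ G) S₂ (neg pVar)) (liftSet S₁) (pos pVar)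

  guard : (AuxVar nI nX 1 → Bool) → Fin (suc m) → Bool
  guard ρ i = markValue (S₂ i) (neg pVar) ρ ∧ markValue (S₁ i) (pos pVar) ρ

  ⟦H⟧≡guarded : ∀ I X X' → ⟦ H ⟧ [ [ I , X ] , X' ] ≡ evalMasked G [ I , X ] (guard [ [ I , X ] , X' ]) zero
  ⟦H⟧≡guarded I X X' = trans (eval-T-liftSet-T (mapVars inj₁ G) S₁ S₂ _ _ _ zero) (evalMasked-mapVars inj₁ G _ _ zero)

  sound : ∀ I X X' → ⟦ H ⟧ [ [ I , X ] , X' ] ≡ true → ⟦ G ⟧ [ I , X ] ≡ true
  sound I X X' e = evalMasked⇒eval G _ _ zero (trans (sym (⟦H⟧≡guarded I X X')) e)

  unguarded : ∀ I X p → (∀ i → eval G [ I , X ] i ≡ true → guard [ [ I , X ] , (λ _ → p) ] i ≡ true) →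
    ⟦ G ⟧ [ I , X ] ≡ true → ⟦ H ⟧ [ [ I , X ] , (λ _ → p) ] ≡ true
  unguarded I X p guarded e = trans (⟦H⟧≡guarded I X _) (trans (evalMasked≡eval G _ _ guarded zero) e)

  complete : ∀ I X → ⟦ G ⟧ [ I , X ] ≡ true → Σ (Fin 1 → Bool) λ X' → ⟦ H ⟧ [ [ I , X ] , X' ] ≡ true
  complete I X e with any? (λ i → S₁ i ∧ eval G [ I , X ] i ≟ true)
  ... | yes (k , ek) = (λ _ → true) , unguarded I X true (λ i eᵢ →
          markValue-neg∧pos _ pVar (S₂ i) (S₁ i)
            (λ _ s₂ → contradiction (trans (sym eᵢ) (G₁⇒¬G₂ I X (k , ∧-conicalˡ _ _ ek , ∧-conicalʳ _ _ ek) i s₂)) λ ())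
            λ ()) e
  ... | no none = (λ _ → false) , unguarded I X false (λ i eᵢ →
          markValue-neg∧pos _ pVar (S₂ i) (S₁ i) (λ ()) λ _ s₁ → none (i , cong₂ _∧_ s₁ eᵢ)) e
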